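{- Let $L$ be the digraph with vertex set $\mathbb{Z}\times\{ -1,0,1\}$ in which $((i,x),(j,y))$ is an edge if and only if $j=i+1$ and either $i$ is even, or $i$ is odd and $x+y\neq 0$. Let $\varphi^1((i,x))=i$ and $\varphi^2((i,x))=i+1$, and let $D$ be the digraph with vertex set $\{(u,v)\in V(L)\times V(L)\mid \varphi^1(u)=\varphi^2(v)\}$ and with $((a,b),(u,v))$ an edge if and only if $(a,u)$ and $(b,v)$ are both edges of $L$. Let $AC_6$ be the alternating $6$-cycle, i.e. the bipartite digraph with initial vertices $u_{ -1},u_0,u_1$, terminal vertices $w_{ -1},w_0,w_1$ and edges $(u_x,w_y)$ for $x+y\neq 0$, and let $K_{3,3}$ be the complete bipartite digraph with three initial and three terminal vertices, all edges directed from initial to terminal vertices. Let $\psi^1:V(K_{3,3})\to\{0,1\}$ and $\psi^2:V(AC_6)\to\{0,1\}$ both map initial vertices to $0$ and terminal vertices to $1$, and let $K_{3,3}\,{}_{\psi^1}\!\!\times_{\psi^2}AC_6$ be the digraph with vertex set $\{(p,q)\in V(K_{3,3})\times V(AC_6)\mid \psi^1(p)=\psi^2(q)\}$ and with $((a,b),(p,q))$ an edge if and only if $(a,p)$ is an edge of $K_{3,3}$ and $(b,q)$ is an edge of $AC_6$. Then the digraph $\Delta(e)$ is, up to isomorphism, independent of the edge $e$ of $D$, so $\Delta(D)$ is well defined, and $$\Delta(D)\cong K_{3,3}\,{}_{\psi^1}\!\!\times_{\psi^2}AC_6,$$ which is connected, $1$-arc transitive, bipartite, but not complete bipartite.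
   Context: An alternating walk is a sequence $(e_i)_{i=0,\dots,n-1}$ of directed edges $e_i=(x_{e_i},y_{e_i})$ in which consecutive edges alternately share their initial vertex and their terminal vertex (i.e. $x_{e_i}=x_{e_{i+1}}$ for every even $i$ and $y_{e_i}=y_{e_{i+1}}$ for every odd $i$, or vice versa). Two edges are reachable from each other if some alternating walk contains both; this is an equivalence relation on the edge set. For an edge $e$, $\Delta(e)$ denotes the subdigraph spanned by the reachability class of $e$, and $\Delta(D)$ denotes this digraph when it is independent of $e$ up to isomorphism. A digraph is $1$-arc transitive if its automorphism group acts transitively on its edges. -}

module Defs where

open import Data.Bool using (Bool; true; false)
open import Data.Fin using (Fin)
open import Data.Integer using (ℤ; +_; -[1+_]; _+_)
open import Data.Integer.Divisibility using (_∣_)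
open import Data.List using (List; []; _∷_)
open import Data.List.Relation.Unary.Any using (Any)
open import Data.Product using (Σ; ∃; ∃-syntax; _×_; _,_; proj₁; proj₂)
open import Data.Sum using (_⊎_)
open import Data.Unit using (⊤)
open import Relation.Binary.PropositionalEquality using (_≡_; _≢_)
open import Relation.Nullary using (¬_)

record Digraph : Set₁ where
  field
    V   : Set
    _≈_ : V → V → Set
    E   : V → V → Set
open Digraph public

fibre : {S : Set} (G₁ G₂ : Digraph) → (V G₁ → S) → (V G₂ → S) → Digraph
fibre {S} G₁ G₂ φ ψ = record
  { V   = Σ (V G₁ × V G₂) (λ p → φ (proj₁ p) ≡ ψ (proj₂ p))
  ; _≈_ = λ p q → (_≈_ G₁ (proj₁ (proj₁ p)) (proj₁ (proj₁ q)))
                × (_≈_ G₂ (proj₂ (proj₁ p)) (proj₂ (proj₁ q)))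
  ; E   = λ p q → E G₁ (proj₁ (proj₁ p)) (proj₁ (proj₁ q))
                × E G₂ (proj₂ (proj₁ p)) (proj₂ (proj₁ q))
  }

Edge : Digraph → Set
Edge G = Σ (V G × V G) (λ p → E G (proj₁ p) (proj₂ p))

src tgt : {G : Digraph} → Edge G → V G
src e = proj₁ (proj₁ e)
tgt e = proj₂ (proj₁ e)

SameEdge : (G : Digraph) → Edge G → Edge G → Set
SameEdge G e f = (_≈_ G (src {G} e) (src {G} f)) × (_≈_ G (tgt {G} e) (tgt {G} f))

AltFrom : (G : Digraph) → Bool → List (Edge G) → Set
AltFrom G b []            = ⊤
AltFrom G b (e ∷ [])      = ⊤
AltFrom G true  (e ∷ f ∷ es) = _≈_ G (src {G} e) (src {G} f) × AltFrom G false (f ∷ es)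
AltFrom G false (e ∷ f ∷ es) = _≈_ G (tgt {G} e) (tgt {G} f) × AltFrom G true (f ∷ es)

AlternatingWalk : (G : Digraph) → List (Edge G) → Set
AlternatingWalk G es = ∃[ b ] AltFrom G b es

Reachable : (G : Digraph) → Edge G → Edge G → Set
Reachable G e f = ∃[ es ] (AlternatingWalk G es
                         × Any (SameEdge G e) es × Any (SameEdge G f) es)

Δ : (G : Digraph) → Edge G → Digraph
Δ G e = record
  { V   = Σ (V G) (λ v → ∃[ f ] (Reachable G e f
                                 × (_≈_ G (src {G} f) v ⊎ _≈_ G (tgt {G} f) v)))
  ; _≈_ = λ v w → _≈_ G (proj₁ v) (proj₁ w)
  ; E   = λ v w → Σ (E G (proj₁ v) (proj₁ w))
                    (λ p → Reachable G e ((proj₁ v , proj₁ w) , p))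
  }

record _≅_ (G H : Digraph) : Set where
  field
    to       : V G → V H
    from     : V H → V G
    to-cong  : ∀ {a b} → _≈_ G a b → _≈_ H (to a) (to b)
    from-cong : ∀ {a b} → _≈_ H a b → _≈_ G (from a) (from b)
    from∘to  : ∀ a → _≈_ G (from (to a)) a
    to∘from  : ∀ b → _≈_ H (to (from b)) b
    edge→    : ∀ a b → E G a b → E H (to a) (to b)
    edge←    : ∀ a b → E H (to a) (to b) → E G a b
open _≅_ public

data Path (G : Digraph) : V G → V G → Set where
  here : ∀ {a b} → _≈_ G a b → Path G a b
  step : ∀ {a b c} → (E G a b ⊎ E G b a) → Path G b c → Path G a c

Connected : Digraph → Set
Connected G = ∀ a b → Path G a b

OneArcTransitive : Digraph → Set
OneArcTransitive G = ∀ a b c d → E G a b → E G c d →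
  ∃[ σ ] (_≈_ G (to {G} {G} σ a) c × _≈_ G (to {G} {G} σ b) d)

Respects : (G : Digraph) → (V G → Bool) → Set
Respects G c = ∀ a b → _≈_ G a b → c a ≡ c b

Bipartite : Digraph → Set
Bipartite G = ∃[ c ] (Respects G c × (∀ a b → E G a b → (c a ≡ false × c b ≡ true)))

CompleteBipartite : Digraph → Set
CompleteBipartite G = ∃[ c ] (Respects G c
  × (∀ a b → E G a b → (c a ≡ false × c b ≡ true))
  × (∀ a b → c a ≡ false → c b ≡ true → E G a b))

data T3 : Set where
  m1 z0 p1 : T3

⟦_⟧ : T3 → ℤ
⟦ m1 ⟧ = -[1+ 0 ]
⟦ z0 ⟧ = + 0
⟦ p1 ⟧ = + 1

Even : ℤ → Set
Even i = (+ 2) ∣ i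

L : Digraph
L = record
  { V   = ℤ × T3
  ; _≈_ = _≡_
  ; E   = λ u v → (proj₁ v ≡ proj₁ u + + 1)
                × (Even (proj₁ u) ⊎ (¬ Even (proj₁ u) × (⟦ proj₂ u ⟧ + ⟦ proj₂ v ⟧ ≢ + 0)))
  }

φ¹ φ² : V L → ℤ
φ¹ u = proj₁ u
φ² u = proj₁ u + + 1

D : Digraph
D = fibre L L φ¹ φ²

-- AC₆ : initial vertices (0,x) = u_x, terminal vertices (1,y) = w_y,
-- edges (u_x , w_y) for x + y ≠ 0
AC6 : Digraph
AC6 = record
  { V   = Fin 2 × T3
  ; _≈_ = _≡_
  ; E   = λ p q → (proj₁ p ≡ Fin.zero) × (proj₁ q ≡ Fin.suc Fin.zero)
                × (⟦ proj₂ p ⟧ + ⟦ proj₂ q ⟧ ≢ + 0)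
  }

K33 : Digraph
K33 = record
  { V   = Fin 2 × Fin 3
  ; _≈_ = _≡_
  ; E   = λ p q → (proj₁ p ≡ Fin.zero) × (proj₁ q ≡ Fin.suc Fin.zero)
  }

ψ¹ : V K33 → Fin 2
ψ¹ p = proj₁ p

ψ² : V AC6 → Fin 2
ψ² q = proj₁ q

K33×AC6 : Digraph
K33×AC6 = fibre K33 AC6 ψ¹ ψ²

module Submission where

-- Alternating walks in D never change the level of an edge (the height of the second coordinate of
-- its source), and any two edges of the same level are joined by a chain in which
-- consecutive edges share a source or a target; hence Δ(e) consists of the edges of one level.
-- An edge of D at a given level is a pair of L-edges, one leaving an even height, which is
-- unconstrained, and one leaving an odd height, which obeys the AC₆ rule; this identifies Δ(e) with
-- K₃,₃ ×ψ AC₆.  The latter is arc-transitive because AC₆ is K₃,₃ minus the perfect matching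
-- u_x — w_(−x), on which every permutation of {−1, 0, 1} acts.

open import Defs
open import Data.Bool using (Bool; true; false; not)
open import Data.Fin using (Fin; zero; suc)
open import Data.Fin.Properties using () renaming (_≟_ to _≟ᶠ_)
open import Data.Integer using (ℤ; +_; _+_; _*_; _≟_)
open import Data.Integer.DivMod using (_/_; _%_; a≡a%n+[a/n]*n; n%d<d)
open import Data.Integer.Divisibility.Signed using (divides; ∣ᵤ⇒∣; ∣⇒∣ᵤ; ∣m+n∣m⇒∣n)
open import Data.Integer.Properties using (+-identityˡ; +-comm; i≢suc[i]; +-0-abelianGroup)
open import Algebra.Properties.AbelianGroup +-0-abelianGroup using (∙-cancelʳ)
open import Data.Integer.Tactic.RingSolver using (solve-∀)
open import Data.List using (List; []; _∷_)
open import Data.List.Relation.Unary.Any using (Any; here; there)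
open import Data.Nat as ℕ using (s≤s)
open import Data.Nat.Divisibility using (∣1⇒≡1)
open import Data.Product using (Σ-syntax; ∃-syntax; _×_; _,_; proj₁; proj₂; swap)
open import Data.Sum using (_⊎_; inj₁; inj₂)
open import Data.Unit using (tt)
open import Function using (id; _∘_; _↔_; Inverse; Injection; mk↔ₛ′)
open import Function.Properties.Inverse using (↔⇒↣)
open import Function.Construct.Composition using (_↔-∘_)
open import Relation.Binary using (Transitive; Symmetric; Reflexive; DecidableEquality)
open import Relation.Binary.Construct.Closure.ReflexiveTransitive using (Star; ε; _◅_; _◅◅_; reverse)
open import Relation.Binary.PropositionalEquality
open import Relation.Nullary using (¬_; Dec; yes; no; contradiction)

≅-trans : {G H J : Digraph} → Transitive (_≈_ G) → Transitive (_≈_ J) → G ≅ H → H ≅ J → G ≅ J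
≅-trans transG transJ i₁ i₂ = record
  { to        = λ a → to i₂ (to i₁ a)
  ; from      = λ c → from i₁ (from i₂ c)
  ; to-cong   = λ p → to-cong i₂ (to-cong i₁ p)
  ; from-cong = λ p → from-cong i₁ (from-cong i₂ p)
  ; from∘to   = λ a → transG (from-cong i₁ (from∘to i₂ (to i₁ a))) (from∘to i₁ a)
  ; to∘from   = λ c → transJ (to-cong i₂ (to∘from i₁ (from i₂ c))) (to∘from i₂ c)
  ; edge→     = λ a b e → edge→ i₂ _ _ (edge→ i₁ a b e)
  ; edge←     = λ a b e → edge← i₁ a b (edge← i₂ _ _ e)
  }

EdgesRespect : Digraph → Set
EdgesRespect H = ∀ {a a′ b b′} → _≈_ H a a′ → _≈_ H b b′ → E H a b → E H a′ b′

≅-sym : {G H : Digraph} → Symmetric (_≈_ H) → EdgesRespect H → G ≅ H → H ≅ G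
≅-sym symH resp i = record
  { to        = from i
  ; from      = to i
  ; to-cong   = from-cong i
  ; from-cong = to-cong i
  ; from∘to   = to∘from i
  ; to∘from   = from∘to i
  ; edge→     = λ a b e → edge← i _ _ (resp (symH (to∘from i a)) (symH (to∘from i b)) e)
  ; edge←     = λ a b e → resp (to∘from i a) (to∘from i b) (edge→ i _ _ e)
  }

Linked : (G : Digraph) → Edge G → Edge G → Set
Linked G f g = _≈_ G (src {G} f) (src {G} g) ⊎ _≈_ G (tgt {G} f) (tgt {G} g)

module _ {G : Digraph} (refl≈ : Reflexive (_≈_ G)) where

  private
    record WalkFrom (b : Bool) (f h : Edge G) : Set where
      constructor walkFrom
      field
        rest        : List (Edge G)
        alternating : AltFrom G b (f ∷ rest)
        reaches     : Any (SameEdge G h) (f ∷ rest)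

    -- An edge shares both endpoints with itself, so repeating it flips the kind of the next link.
    stutter : ∀ b {f h} → WalkFrom b f h → WalkFrom (not b) f h
    stutter true  {f} (walkFrom es alt h∈) = walkFrom (f ∷ es) (refl≈ , alt) (there h∈)
    stutter false {f} (walkFrom es alt h∈) = walkFrom (f ∷ es) (refl≈ , alt) (there h∈)

    consˢ : ∀ {f g h} → _≈_ G (src {G} f) (src {G} g) → WalkFrom false g h → WalkFrom true f h
    consˢ {g = g} p (walkFrom es alt h∈) = walkFrom (g ∷ es) (p , alt) (there h∈)

    consᵗ : ∀ {f g h} → _≈_ G (tgt {G} f) (tgt {G} g) → WalkFrom true g h → WalkFrom false f h
    consᵗ {g = g} p (walkFrom es alt h∈) = walkFrom (g ∷ es) (p , alt) (there h∈)

    walk : ∀ b {f h} → Star (Linked G) f h → WalkFrom b f h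
    walk b     ε                = walkFrom [] tt (here (refl≈ , refl≈))
    walk true  (inj₁ p ◅ links) = consˢ p (walk false links)
    walk false (inj₂ p ◅ links) = consᵗ p (walk true links)
    walk true  (inj₂ p ◅ links) = stutter false (consᵗ p (walk true links))
    walk false (inj₁ p ◅ links) = stutter true (consˢ p (walk false links))

  star⇒reachable : ∀ {f h} → Star (Linked G) f h → Reachable G f h
  star⇒reachable {f} links with walk true links
  ... | walkFrom es alt h∈ = f ∷ es , (true , alt) , here (refl≈ , refl≈) , h∈

module _ {G : Digraph} {A : Set} (h : Edge G → A) (linked : ∀ {f g} → Linked G f g → h f ≡ h g) where

  reachable-invariant : ∀ {e f} → Reachable G e f → h e ≡ h f
  reachable-invariant ([] , _ , () , _)
  reachable-invariant (g ∷ es , (b , alt) , e∈ , f∈) =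
    trans (along b g es alt e∈) (sym (along b g es alt f∈))
    where
    along : ∀ b g es {k} → AltFrom G b (g ∷ es) → Any (SameEdge G k) (g ∷ es) → h k ≡ h g
    along b g es _ (here same) = linked (inj₁ (proj₁ same))
    along true  g (g′ ∷ es) (p , alt) (there k∈) = trans (along false g′ es alt k∈) (sym (linked (inj₁ p)))
    along false g (g′ ∷ es) (p , alt) (there k∈) = trans (along true g′ es alt k∈) (sym (linked (inj₂ p)))

module Transposition {A : Set} (_≟_ : DecidableEquality A) where

  transpose : A → A → A → A
  transpose x y z with z ≟ x
  ... | yes _ = y
  ... | no _ with z ≟ y
  ...   | yes _ = x
  ...   | no _  = z

  transpose-matchˡ : ∀ x y → transpose x y x ≡ y
  transpose-matchˡ x y with x ≟ x
  ... | yes _  = refl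
  ... | no x≢x = contradiction refl x≢x

  transpose-matchʳ : ∀ x y → transpose x y y ≡ x
  transpose-matchʳ x y with y ≟ x
  ... | yes y≡x = y≡x
  ... | no _ with y ≟ y
  ...   | yes _  = refl
  ...   | no y≢y = contradiction refl y≢y

  transpose-miss : ∀ {x y z} → z ≢ x → z ≢ y → transpose x y z ≡ z
  transpose-miss {x} {y} {z} z≢x z≢y with z ≟ x
  ... | yes z≡x = contradiction z≡x z≢x
  ... | no _ with z ≟ y
  ...   | yes z≡y = contradiction z≡y z≢y
  ...   | no _    = refl

  transpose-involutive : ∀ x y z → transpose x y (transpose x y z) ≡ z
  transpose-involutive x y z with z ≟ x
  ... | yes refl = transpose-matchʳ z y
  ... | no z≢x with z ≟ y
  ...   | yes refl = transpose-matchˡ x z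
  ...   | no z≢y   = transpose-miss z≢x z≢y

  transposition : A → A → A ↔ A
  transposition x y =
    mk↔ₛ′ (transpose x y) (transpose x y) (transpose-involutive x y) (transpose-involutive x y)

  -- First move x to x′, then whatever y became to y′; the second swap fixes x′.
  distinctPair-transitive : ∀ {x y x′ y′} → x ≢ y → x′ ≢ y′ →
                            Σ[ π ∈ A ↔ A ] (Inverse.to π x ≡ x′ × Inverse.to π y ≡ y′)
  distinctPair-transitive {x} {y} {x′} {y′} x≢y x′≢y′ =
    transposition y₁ y′ ↔-∘ transposition x x′ ,
    trans (cong (transpose y₁ y′) (transpose-matchˡ x x′)) (transpose-miss x′≢y₁ x′≢y′) ,
    transpose-matchˡ y₁ y′
    where
    y₁ = transpose x x′ y
    x′≢y₁ : x′ ≢ y₁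
    x′≢y₁ x′≡y₁ = x≢y (begin
      x                  ≡⟨ transpose-matchʳ x x′ ⟨
      transpose x x′ x′  ≡⟨ cong (transpose x x′) x′≡y₁ ⟩
      transpose x x′ y₁  ≡⟨ transpose-involutive x x′ y ⟩
      y                  ∎)
      where open ≡-Reasoning

_≟ₜ_ : DecidableEquality T3
m1 ≟ₜ m1 = yes refl
m1 ≟ₜ z0 = no λ ()
m1 ≟ₜ p1 = no λ ()
z0 ≟ₜ m1 = no λ ()
z0 ≟ₜ z0 = yes refl
z0 ≟ₜ p1 = no λ ()
p1 ≟ₜ m1 = no λ ()
p1 ≟ₜ z0 = no λ ()
p1 ≟ₜ p1 = yes refl

neg : T3 → T3
neg m1 = p1
neg z0 = z0
neg p1 = m1

neg-involutive : ∀ x → neg (neg x) ≡ x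
neg-involutive m1 = refl
neg-involutive z0 = refl
neg-involutive p1 = refl

neg↔ : T3 ↔ T3
neg↔ = mk↔ₛ′ neg neg neg-involutive neg-involutive

NonOpposite : T3 → T3 → Set
NonOpposite x y = ⟦ x ⟧ + ⟦ y ⟧ ≢ + 0

nonOpposite-sym : ∀ {x y} → NonOpposite x y → NonOpposite y x
nonOpposite-sym {x} {y} n sum≡0 = n (trans (+-comm ⟦ x ⟧ ⟦ y ⟧) sum≡0)

nonOpposite⇒≢neg : ∀ {x y} → NonOpposite x y → x ≢ neg y
nonOpposite⇒≢neg {y = m1} n refl = n refl
nonOpposite⇒≢neg {y = z0} n refl = n refl
nonOpposite⇒≢neg {y = p1} n refl = n refl

≢neg⇒nonOpposite : ∀ {x y} → x ≢ neg y → NonOpposite x y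
≢neg⇒nonOpposite {m1} {p1} x≢ _ = x≢ refl
≢neg⇒nonOpposite {z0} {z0} x≢ _ = x≢ refl
≢neg⇒nonOpposite {p1} {m1} x≢ _ = x≢ refl
≢neg⇒nonOpposite {m1} {m1} _ ()
≢neg⇒nonOpposite {m1} {z0} _ ()
≢neg⇒nonOpposite {z0} {m1} _ ()
≢neg⇒nonOpposite {z0} {p1} _ ()
≢neg⇒nonOpposite {p1} {z0} _ ()
≢neg⇒nonOpposite {p1} {p1} _ ()

partner : T3 → T3
partner m1 = m1
partner z0 = m1
partner p1 = z0

nonOpposite-partner : ∀ x → NonOpposite x (partner x)
nonOpposite-partner m1 ()
nonOpposite-partner z0 ()
nonOpposite-partner p1 ()

nonOpposite-m1-partner : ∀ x → NonOpposite m1 (partner x)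
nonOpposite-m1-partner m1 ()
nonOpposite-m1-partner z0 ()
nonOpposite-m1-partner p1 ()

toFin : T3 → Fin 3
toFin m1 = zero
toFin z0 = suc zero
toFin p1 = suc (suc zero)

fromFin : Fin 3 → T3
fromFin zero             = m1
fromFin (suc zero)       = z0
fromFin (suc (suc zero)) = p1

fromFin-toFin : ∀ x → fromFin (toFin x) ≡ x
fromFin-toFin m1 = refl
fromFin-toFin z0 = refl
fromFin-toFin p1 = refl

toFin-fromFin : ∀ k → toFin (fromFin k) ≡ k
toFin-fromFin zero             = refl
toFin-fromFin (suc zero)       = refl
toFin-fromFin (suc (suc zero)) = refl

data Parity (j : ℤ) : Set where
  even : Even j → ¬ Even (j + + 1) → Parity j
  odd  : ¬ Even j → Even (j + + 1) → Parity j

¬even∧even-suc : ∀ j → Even j → ¬ Even (j + + 1)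
¬even∧even-suc j 2∣j 2∣j+1
  with ∣1⇒≡1 (∣⇒∣ᵤ {+ 2} {+ 1} (∣m+n∣m⇒∣n {m = j} (∣ᵤ⇒∣ 2∣j+1) (∣ᵤ⇒∣ 2∣j)))
... | ()

even⊎even-suc : ∀ j → Even j ⊎ Even (j + + 1)
even⊎even-suc j with j % + 2 | a≡a%n+[a/n]*n j (+ 2) | n%d<d j (+ 2)
... | 0 | j≡ | _ = inj₁ (∣⇒∣ᵤ (divides (j / + 2) (trans j≡ (+-identityˡ _))))
... | 1 | j≡ | _ = inj₂ (∣⇒∣ᵤ (divides (j / + 2 + + 1) (trans (cong (_+ + 1) j≡) (shift (j / + 2)))))
  where
  shift : ∀ q → (+ 1 + q * + 2) + + 1 ≡ (q + + 1) * + 2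
  shift = solve-∀
... | ℕ.suc (ℕ.suc _) | _ | s≤s (s≤s ())

parity : ∀ j → Parity j
parity j with even⊎even-suc j
... | inj₁ 2∣j   = even 2∣j (¬even∧even-suc j 2∣j)
... | inj₂ 2∣j+1 = odd (λ 2∣j → ¬even∧even-suc j 2∣j 2∣j+1) 2∣j+1

height : V D → ℤ
height w = proj₁ (proj₂ (proj₁ w))

level : Edge D → ℤ
level f = height (src {D} f)

height-tgt : (f : Edge D) → height (tgt {D} f) ≡ level f + + 1
height-tgt f = proj₁ (proj₂ (proj₂ f))

j+1≢j : ∀ j → j + + 1 ≢ j
j+1≢j j eq = i≢suc[i] (sym (trans (+-comm (+ 1) j) eq))

linked-sym : ∀ {f g} → Linked D f g → Linked D g f
linked-sym (inj₁ (p , q)) = inj₁ (sym p , sym q)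
linked-sym (inj₂ (p , q)) = inj₂ (sym p , sym q)

linked-level : ∀ {f g} → Linked D f g → level f ≡ level g
linked-level (inj₁ (_ , v≡v′)) = cong proj₁ v≡v′
linked-level {f} {g} (inj₂ (_ , v≡v′)) =
  ∙-cancelʳ (+ 1) (level f) (level g) (trans (sym (height-tgt f)) (trans (cong proj₁ v≡v′) (height-tgt g)))

reachable-level : ∀ {e f} → Reachable D e f → level e ≡ level f
reachable-level {e} {f} = reachable-invariant {G = D} level (λ {g} {h} → linked-level {g} {h}) {e} {f}

labels : V D → T3 × T3
labels w = proj₂ (proj₁ (proj₁ w)) , proj₂ (proj₂ (proj₁ w))

-- At level j, coords turns the labels (x , y) of a vertex (u , v) into (K₃,₃ coordinate , AC₆
-- coordinate): the label on the side whose L-edge leaves an odd height is the AC₆ coordinate.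
coords : ∀ {j} → Parity j → T3 × T3 → T3 × T3
coords (even _ _) = swap
coords (odd _ _)  = id

coords-involutive : ∀ {j} (p : Parity j) c → coords p (coords p c) ≡ c
coords-involutive (even _ _) c = refl
coords-involutive (odd _ _)  c = refl

acLabel : ∀ {j} → Parity j → V D → T3
acLabel p w = proj₂ (coords p (labels w))

D-edge⇒nonOpposite : ∀ {j} (p : Parity j) {w w′ : V D} → height w ≡ j → E D w w′ →
                     NonOpposite (acLabel p w) (acLabel p w′)
D-edge⇒nonOpposite (even _ ¬2∣j+1) {w = _ , refl} refl ((_ , inj₁ 2∣j+1) , _) = contradiction 2∣j+1 ¬2∣j+1
D-edge⇒nonOpposite (even _ _)      {w = _ , refl} refl ((_ , inj₂ (_ , n)) , _) = n
D-edge⇒nonOpposite (odd ¬2∣j _)    refl (_ , (_ , inj₁ 2∣j))                     = contradiction 2∣j ¬2∣j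
D-edge⇒nonOpposite (odd _ _)       refl (_ , (_ , inj₂ (_ , n)))                 = n

nonOpposite⇒D-edge : ∀ {j} (p : Parity j) {w w′ : V D} → height w ≡ j → height w′ ≡ j + + 1 →
                     NonOpposite (acLabel p w) (acLabel p w′) → E D w w′
nonOpposite⇒D-edge (even 2∣j ¬2∣j+1) {_ , refl} {_ , refl} refl refl n =
  (refl , inj₂ (¬2∣j+1 , n)) , (refl , inj₁ 2∣j)
nonOpposite⇒D-edge (odd ¬2∣j 2∣j+1)  {_ , refl} {_ , refl} refl refl n =
  (refl , inj₁ 2∣j+1) , (refl , inj₂ (¬2∣j , n))

side : ∀ {P : Set} → Dec P → Fin 2
side (yes _) = zero
side (no _)  = suc zero

side-yes : ∀ {P : Set} (d : Dec P) → P → side d ≡ zero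
side-yes (yes _) _  = refl
side-yes (no ¬p) p = contradiction p ¬p

side-no : ∀ {P : Set} (d : Dec P) → ¬ P → side d ≡ suc zero
side-no (yes p) ¬p = contradiction p ¬p
side-no (no _)  _  = refl

module Layer (j : ℤ) where

  par : Parity j
  par = parity j

  base : Fin 2 → ℤ
  base zero       = j
  base (suc zero) = j + + 1

  vertexAt : Fin 2 → T3 × T3 → V D
  vertexAt s c = ((base s + + 1 , proj₁ (coords par c)) , (base s , proj₂ (coords par c))) , refl

  edgeAt : (c c′ : T3 × T3) → NonOpposite (proj₂ c) (proj₂ c′) → Edge D
  edgeAt c c′ n = (vertexAt zero c , vertexAt (suc zero) c′) ,
    nonOpposite⇒D-edge par {vertexAt zero c} {vertexAt (suc zero) c′} refl refl
      (subst₂ NonOpposite (cong proj₂ (sym (coords-involutive par c)))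
                          (cong proj₂ (sym (coords-involutive par c′))) n)

  canonical : Edge D
  canonical = edgeAt (z0 , m1) (z0 , m1) λ ()

  ≈vertexAt : ∀ s (w : V D) → height w ≡ base s → _≈_ D w (vertexAt s (coords par (labels w)))
  ≈vertexAt s (((_ , x) , _) , refl) refl =
    cong (base s + + 1 ,_) (cong proj₁ (sym inv)) , cong (base s ,_) (cong proj₂ (sym inv))
    where inv = coords-involutive par (x , _)

  -- Keep the source and move the target to (z0 , partner a), keep that target and move the source
  -- to (z0 , m1), then keep the source.
  linked-canonical : (f : Edge D) → level f ≡ j → Star (Linked D) f canonical
  linked-canonical f f∈j =
    _◅_ {j = g₁} (inj₁ (≈vertexAt zero (src {D} f) f∈j))
      (_◅_ {j = g₂} (inj₂ (refl , refl))
        (inj₁ (refl , refl) ◅ ε))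
    where
    c = coords par (labels (src {D} f))
    a = proj₂ c
    g₁ = edgeAt c (z0 , partner a) (nonOpposite-partner a)
    g₂ = edgeAt (z0 , m1) (z0 , partner a) (nonOpposite-m1-partner a)

  sideOf : V D → Fin 2
  sideOf w = side (height w ≟ j)

  sideOf-vertexAt : ∀ s c → sideOf (vertexAt s c) ≡ s
  sideOf-vertexAt zero       c = side-yes (j ≟ j) refl
  sideOf-vertexAt (suc zero) c = side-no (j + + 1 ≟ j) (j+1≢j j)

  height≡base-sideOf : (w : V D) → height w ≡ j ⊎ height w ≡ j + + 1 → height w ≡ base (sideOf w)
  height≡base-sideOf w = at (height w ≟ j)
    where
    at : ∀ {h} (d : Dec (h ≡ j)) → h ≡ j ⊎ h ≡ j + + 1 → h ≡ base (side d)
    at (yes h≡j) _          = h≡j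
    at (no h≢j) (inj₁ h≡j)  = contradiction h≡j h≢j
    at (no _)   (inj₂ h≡j+1) = h≡j+1

level≡⇒reachable : ∀ {e f} → level e ≡ level f → Reachable D e f
level≡⇒reachable {e} {f} e≡f =
  star⇒reachable (refl , refl)
    (linked-canonical e refl ◅◅ reverse (λ {g} {h} → linked-sym {g} {h}) (linked-canonical f (sym e≡f)))
  where open Layer (level e)

Δ-height : (e : Edge D) (v : V (Δ D e)) → height (proj₁ v) ≡ level e ⊎ height (proj₁ v) ≡ level e + + 1
Δ-height e (_ , f , e~f , inj₁ (_ , v≡)) =
  inj₁ (trans (sym (cong proj₁ v≡)) (sym (reachable-level {e} {f} e~f)))
Δ-height e (_ , f , e~f , inj₂ (_ , v≡)) =
  inj₂ (trans (sym (cong proj₁ v≡))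
              (trans (height-tgt f) (cong (_+ + 1) (sym (reachable-level {e} {f} e~f)))))

Δ-≈-trans : (e : Edge D) → Transitive (_≈_ (Δ D e))
Δ-≈-trans e (p , q) (p′ , q′) = trans p p′ , trans q q′

Δ≅K33×AC6 : (e : Edge D) → Δ D e ≅ K33×AC6
Δ≅K33×AC6 e = record
  { to        = λ v → toK (proj₁ v)
  ; from      = fromK
  ; to-cong   = λ {v} {v′} → to-cong′ {v} {v′}
  ; from-cong = λ {t} {t′} → from-cong′ {t} {t′}
  ; from∘to   = from∘to′
  ; to∘from   = to∘from′
  ; edge→     = edge→′
  ; edge←     = edge←′
  }
  where
  open Layer (level e)

  toK : V D → V K33×AC6
  toK w = ((sideOf w , toFin (proj₁ c)) , (sideOf w , proj₂ c)) , refl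
    where c = coords par (labels w)

  endpoint : ∀ s c → ∃[ f ] (Reachable D e f ×
                              (_≈_ D (src {D} f) (vertexAt s c) ⊎ _≈_ D (tgt {D} f) (vertexAt s c)))
  endpoint zero       (k , a) = f , level≡⇒reachable {e} {f} refl , inj₁ (refl , refl)
    where f = edgeAt (k , a) (k , partner a) (nonOpposite-partner a)
  endpoint (suc zero) (k , a) = f , level≡⇒reachable {e} {f} refl , inj₂ (refl , refl)
    where f = edgeAt (k , partner a) (k , a) (nonOpposite-sym {a} (nonOpposite-partner a))

  fromK : V K33×AC6 → V (Δ D e)
  fromK (((s , k) , (_ , a)) , _) = vertexAt s (fromFin k , a) , endpoint s (fromFin k , a)

  height≡base : (v : V (Δ D e)) → height (proj₁ v) ≡ base (sideOf (proj₁ v))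
  height≡base v = height≡base-sideOf (proj₁ v) (Δ-height e v)

  to-cong′ : ∀ {v v′} → _≈_ (Δ D e) v v′ → _≈_ K33×AC6 (toK (proj₁ v)) (toK (proj₁ v′))
  to-cong′ {(_ , _) , _} {(_ , _) , _} (refl , refl) = refl , refl

  from-cong′ : ∀ {t t′} → _≈_ K33×AC6 t t′ → _≈_ (Δ D e) (fromK t) (fromK t′)
  from-cong′ {(_ , _) , _} {(_ , _) , _} (refl , refl) = refl , refl

  from∘to′ : ∀ v → _≈_ (Δ D e) (fromK (toK (proj₁ v))) v
  from∘to′ v@(w , _) =
    subst (λ c → _≈_ D (vertexAt (sideOf w) c) w) (sym (cong (_, proj₂ c) (fromFin-toFin (proj₁ c))))
          (sym (proj₁ w≈) , sym (proj₂ w≈))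
    where
    c  = coords par (labels w)
    w≈ = ≈vertexAt (sideOf w) w (height≡base v)

  to∘from′ : ∀ t → _≈_ K33×AC6 (toK (proj₁ (fromK t))) t
  to∘from′ (((s , k) , (_ , a)) , s≡s′) =
    cong₂ _,_ (sideOf-vertexAt s c) (trans (cong (toFin ∘ proj₁) inv) (toFin-fromFin k)) ,
    cong₂ _,_ (trans (sideOf-vertexAt s c) s≡s′) (cong proj₂ inv)
    where
    c   = fromFin k , a
    inv = coords-involutive par c

  edge→′ : ∀ v v′ → E (Δ D e) v v′ → E K33×AC6 (toK (proj₁ v)) (toK (proj₁ v′))
  edge→′ (w , _) (w′ , _) (w→w′ , e~f) =
    (side₀ , side₁) , (side₀ , side₁ , D-edge⇒nonOpposite par {w} {w′} h≡j w→w′)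
    where
    h≡j     = sym (reachable-level {e} {(w , w′) , w→w′} e~f)
    h′≡j+1  = trans (proj₁ (proj₂ w→w′)) (cong (_+ + 1) h≡j)
    side₀   = side-yes (height w ≟ level e) h≡j
    side₁   = side-no (height w′ ≟ level e) (λ h′≡j → j+1≢j (level e) (trans (sym h′≡j+1) h′≡j))

  edge←′ : ∀ v v′ → E K33×AC6 (toK (proj₁ v)) (toK (proj₁ v′)) → E (Δ D e) v v′
  edge←′ v@(w , _) v′@(w′ , _) ((side₀ , side₁) , (_ , _ , n)) =
    w→w′ , level≡⇒reachable {e} {(w , w′) , w→w′} (sym h≡j)
    where
    h≡j  = trans (height≡base v) (cong base side₀)
    h′≡j+1 = trans (height≡base v′) (cong base side₁)
    w→w′ = nonOpposite⇒D-edge par {w} {w′} h≡j h′≡j+1 n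

K33×AC6-respects : EdgesRespect K33×AC6
K33×AC6-respects (refl , refl) (refl , refl) a→b = a→b

K33×AC6-≈-sym : Symmetric (_≈_ K33×AC6)
K33×AC6-≈-sym (p , q) = sym p , sym q

initial terminal : Fin 3 → T3 → V K33×AC6
initial  k a = ((zero , k) , (zero , a)) , refl
terminal k a = ((suc zero , k) , (suc zero , a)) , refl

arc : ∀ k a l b → NonOpposite a b → E K33×AC6 (initial k a) (terminal l b)
arc _ _ _ _ n = (refl , refl) , (refl , refl , n)

module _ where
  private
    G = K33×AC6
    hub = initial zero m1

  forward : ∀ {k a c} l b → NonOpposite a b → Path G (terminal l b) c → Path G (initial k a) c
  forward {k} {a} l b n p = step {b = terminal l b} (inj₁ (arc k a l b n)) p

  backward : ∀ {k a c} l b → NonOpposite b a → Path G (initial l b) c → Path G (terminal k a) c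
  backward {k} {a} l b n p = step {b = initial l b} (inj₂ (arc l b k a n)) p

  hub⇝initial : ∀ k a {c} → Path G (initial k a) c → Path G hub c
  hub⇝initial k a p =
    forward zero (partner a) (nonOpposite-m1-partner a) (backward k a (nonOpposite-partner a) p)

  initial⇝hub : ∀ k a {c} → Path G hub c → Path G (initial k a) c
  initial⇝hub k a p =
    forward zero (partner a) (nonOpposite-partner a) (backward zero m1 (nonOpposite-m1-partner a) p)

  K33×AC6-connected : Connected G
  K33×AC6-connected v w = to-hub v (from-hub w)
    where
    from-hub : ∀ w → Path G hub w
    from-hub (((zero , k) , (zero , a)) , refl) = hub⇝initial k a (here (refl , refl))
    from-hub (((suc zero , k) , (suc zero , a)) , refl) =
      hub⇝initial zero (partner a)
        (forward k a (nonOpposite-sym {a} (nonOpposite-partner a)) (here (refl , refl)))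

    to-hub : ∀ v {c} → Path G hub c → Path G v c
    to-hub (((zero , k) , (zero , a)) , refl) p = initial⇝hub k a p
    to-hub (((suc zero , k) , (suc zero , a)) , refl) p =
      backward zero (partner a) (nonOpposite-sym {a} (nonOpposite-partner a))
        (initial⇝hub zero (partner a) p)

side→Bool : Fin 2 → Bool
side→Bool zero    = false
side→Bool (suc _) = true

K33×AC6-bipartite : Bipartite K33×AC6
K33×AC6-bipartite =
  (λ v → side→Bool (proj₁ (proj₁ (proj₁ v)))) ,
  (λ { _ _ (p , _) → cong (side→Bool ∘ proj₁) p }) ,
  (λ { _ _ ((p , q) , _) → cong side→Bool p , cong side→Bool q })

K33×AC6-¬complete : ¬ CompleteBipartite K33×AC6
K33×AC6-¬complete (_ , _ , bip , complete)
  with complete (initial zero m1) (terminal zero p1)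
                (proj₁ (bip (initial zero m1) (terminal zero m1) (arc zero m1 zero m1 λ ())))
                (proj₂ (bip (initial zero p1) (terminal zero p1) (arc zero p1 zero p1 λ ())))
... | _ , (_ , _ , n) = n refl

act : {A : Set} → (Fin 2 → A ↔ A) → Fin 2 × A → Fin 2 × A
act σ (s , x) = s , Inverse.to (σ s) x

act⁻¹ : {A : Set} → (Fin 2 → A ↔ A) → Fin 2 × A → Fin 2 × A
act⁻¹ σ (s , x) = s , Inverse.from (σ s) x

act⁻¹-act : {A : Set} (σ : Fin 2 → A ↔ A) → ∀ p → act⁻¹ σ (act σ p) ≡ p
act⁻¹-act σ (s , x) = cong (s ,_) (Inverse.strictlyInverseʳ (σ s) x)

act-act⁻¹ : {A : Set} (σ : Fin 2 → A ↔ A) → ∀ p → act σ (act⁻¹ σ p) ≡ p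
act-act⁻¹ σ (s , x) = cong (s ,_) (Inverse.strictlyInverseˡ (σ s) x)

-- A permutation π of the initial vertices of AC₆ extends to an automorphism by acting on the
-- terminal vertices as neg ∘ π ∘ neg, because u_x → w_y exactly when x ≢ neg y.
acAction : T3 ↔ T3 → Fin 2 → T3 ↔ T3
acAction π zero       = π
acAction π (suc zero) = neg↔ ↔-∘ (π ↔-∘ neg↔)

module _ (π : T3 ↔ T3) where
  private
    π⟨_⟩ : T3 → T3
    π⟨_⟩ = Inverse.to π

  nonOpposite-conj : ∀ {a b} → NonOpposite a b → NonOpposite π⟨ a ⟩ (neg π⟨ neg b ⟩)
  nonOpposite-conj {a} {b} n = ≢neg⇒nonOpposite λ πa≡ →
    nonOpposite⇒≢neg n (Injection.injective (↔⇒↣ π) (trans πa≡ (neg-involutive π⟨ neg b ⟩)))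

  nonOpposite-conj⁻¹ : ∀ {a b} → NonOpposite π⟨ a ⟩ (neg π⟨ neg b ⟩) → NonOpposite a b
  nonOpposite-conj⁻¹ {a} {b} n = ≢neg⇒nonOpposite λ a≡ →
    nonOpposite⇒≢neg {π⟨ a ⟩} n (trans (cong π⟨_⟩ a≡) (sym (neg-involutive π⟨ neg b ⟩)))

  acAction-arc : ∀ p q → proj₁ p ≡ zero → proj₁ q ≡ suc zero → NonOpposite (proj₂ p) (proj₂ q) →
                 NonOpposite (proj₂ (act (acAction π) p)) (proj₂ (act (acAction π) q))
  acAction-arc (zero , _) (suc zero , _) refl refl = nonOpposite-conj

  acAction-arc⁻¹ : ∀ p q → proj₁ p ≡ zero → proj₁ q ≡ suc zero →
                   NonOpposite (proj₂ (act (acAction π) p)) (proj₂ (act (acAction π) q)) →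
                   NonOpposite (proj₂ p) (proj₂ q)
  acAction-arc⁻¹ (zero , _) (suc zero , _) refl refl = nonOpposite-conj⁻¹

K33×AC6-automorphism : (Fin 2 → Fin 3 ↔ Fin 3) → T3 ↔ T3 → K33×AC6 ≅ K33×AC6
K33×AC6-automorphism κ π = record
  { to        = λ v → (act κ (proj₁ (proj₁ v)) , act α (proj₂ (proj₁ v))) , proj₂ v
  ; from      = λ v → (act⁻¹ κ (proj₁ (proj₁ v)) , act⁻¹ α (proj₂ (proj₁ v))) , proj₂ v
  ; to-cong   = λ (p , q) → cong (act κ) p , cong (act α) q
  ; from-cong = λ (p , q) → cong (act⁻¹ κ) p , cong (act⁻¹ α) q
  ; from∘to   = λ v → act⁻¹-act κ (proj₁ (proj₁ v)) , act⁻¹-act α (proj₂ (proj₁ v))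
  ; to∘from   = λ v → act-act⁻¹ κ (proj₁ (proj₁ v)) , act-act⁻¹ α (proj₂ (proj₁ v))
  ; edge→     = λ v w (k-arc , (p , q , n)) →
                  k-arc , (p , q , acAction-arc π (proj₂ (proj₁ v)) (proj₂ (proj₁ w)) p q n)
  ; edge←     = λ v w (k-arc , (p , q , n)) →
                  k-arc , (p , q , acAction-arc⁻¹ π (proj₂ (proj₁ v)) (proj₂ (proj₁ w)) p q n)
  }
  where α = acAction π

module FinTransposition = Transposition (_≟ᶠ_ {3})
module T3Transposition  = Transposition _≟ₜ_

K33×AC6-arcTransitive : OneArcTransitive K33×AC6
K33×AC6-arcTransitive (((_ , k₀) , (_ , a₀)) , _) (((_ , k₁) , (_ , a₁)) , _)
                      (((_ , k₂) , (_ , a₂)) , _) (((_ , k₃) , (_ , a₃)) , _)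
                      ((refl , refl) , (refl , refl , n₀₁)) ((refl , refl) , (refl , refl , n₂₃)) =
  K33×AC6-automorphism κ (proj₁ π) ,
  (cong (zero ,_) (FinTransposition.transpose-matchˡ k₀ k₂) , cong (zero ,_) (proj₁ (proj₂ π))) ,
  (cong (suc zero ,_) (FinTransposition.transpose-matchˡ k₁ k₃) ,
   cong (suc zero ,_) (trans (cong neg (proj₂ (proj₂ π))) (neg-involutive a₃)))
  where
  κ : Fin 2 → Fin 3 ↔ Fin 3
  κ zero       = FinTransposition.transposition k₀ k₂
  κ (suc zero) = FinTransposition.transposition k₁ k₃
  π = T3Transposition.distinctPair-transitive (nonOpposite⇒≢neg {a₀} {a₁} n₀₁)
                                              (nonOpposite⇒≢neg {a₂} {a₃} n₂₃)

Δ-independent : (e f : Edge D) → Δ D e ≅ Δ D f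
Δ-independent e f =
  ≅-trans {Δ D e} {K33×AC6} {Δ D f}
          (λ {u v w} → Δ-≈-trans e {u} {v} {w}) (λ {u v w} → Δ-≈-trans f {u} {v} {w})
          (Δ≅K33×AC6 e)
          (≅-sym {Δ D f} (λ {u v} → K33×AC6-≈-sym {u} {v})
                         (λ {a a′ b b′} → K33×AC6-respects {a} {a′} {b} {b′})
                         (Δ≅K33×AC6 f))

mainTheorem3 : ((e f : Edge D) → Δ D e ≅ Δ D f)
    × ((e : Edge D) → Δ D e ≅ K33×AC6)
    × Connected K33×AC6
    × OneArcTransitive K33×AC6
    × Bipartite K33×AC6
    × ¬ CompleteBipartite K33×AC6
mainTheorem3 =
  Δ-independent ,
  Δ≅K33×AC6 ,
  K33×AC6-connected ,
  K33×AC6-arcTransitive ,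
  K33×AC6-bipartite ,
  K33×AC6-¬complete
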